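{- Let $G$ be a chordal graph and $I\subseteq V(G)$. Let $G'=G-E(G[I])$ be the graph obtained from $G$ by deleting all edges with both endpoints in $I$. Then $G'$ is perfect.
   Context: All graphs are finite, simple and undirected. A graph is chordal if every cycle of length at least $4$ has a chord (an edge joining two non-consecutive vertices of the cycle). A graph is perfect if for every induced subgraph the chromatic number equals the clique number. -}

module Defs where

open import Data.Nat using (ℕ; zero; suc; _≤_; _∸_)
open import Data.Fin using (Fin; toℕ)
open import Data.Fin.Subset using (Subset)
open import Data.Vec using (lookup)
open import Data.Bool using (Bool; true; false; _∧_; not)
open import Data.Bool.Properties using (∧-comm)
open import Data.Product using (Σ; ∃; _×_; _,_; proj₁)
open import Data.Sum using (_⊎_)
open import Relation.Nullary using (¬_)
open import Relation.Binary.PropositionalEquality using (_≡_; _≢_; refl; cong₂)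
open import Function.Definitions using (Injective)

record Graph (V : Set) : Set where
  field
    adj   : V → V → Bool
    sym   : ∀ u v → adj u v ≡ adj v u
    irref : ∀ v → adj v v ≡ false
open Graph public

Adj : ∀ {V} → Graph V → V → V → Set
Adj G u v = adj G u v ≡ true

FinGraph : ℕ → Set
FinGraph n = Graph (Fin n)

InducedVertex : ∀ {n} → Subset n → Set
InducedVertex {n} S = Σ (Fin n) (λ v → lookup S v ≡ true)

induced : ∀ {n} → FinGraph n → (S : Subset n) → Graph (InducedVertex S)
induced G S = record
  { adj   = λ u v → adj G (proj₁ u) (proj₁ v)
  ; sym   = λ u v → sym G (proj₁ u) (proj₁ v)
  ; irref = λ v → irref G (proj₁ v) }

deleteInsideEdges : ∀ {n} → FinGraph n → Subset n → FinGraph n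
deleteInsideEdges G I = record
  { adj   = λ u v → adj G u v ∧ not (lookup I u ∧ lookup I v)
  ; sym   = λ u v → cong₂ (λ a b → a ∧ not b) (sym G u v) (∧-comm (lookup I u) (lookup I v))
  ; irref = λ v → cong₂ (λ a b → a ∧ not b) (irref G v) refl }

Consec : ∀ {k} → Fin k → Fin k → Set
Consec {k} i j = (toℕ j ≡ suc (toℕ i)) ⊎ ((toℕ i ≡ k ∸ 1) × (toℕ j ≡ 0))

record Cycle {V : Set} (G : Graph V) (k : ℕ) : Set where
  field
    vtx      : Fin k → V
    distinct : Injective _≡_ _≡_ vtx
    edges    : ∀ i j → Consec i j → Adj G (vtx i) (vtx j)
open Cycle public

HasChord : ∀ {V} {G : Graph V} {k} → Cycle G k → Set
HasChord {G = G} {k} C =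
  ∃ λ (i : Fin k) → ∃ λ (j : Fin k) →
    i ≢ j × ¬ Consec i j × ¬ Consec j i × Adj G (vtx C i) (vtx C j)

Chordal : ∀ {V} → Graph V → Set
Chordal G = ∀ k → 4 ≤ k → (C : Cycle G k) → HasChord C

Colorable : ∀ {V} → Graph V → ℕ → Set
Colorable {V} G k = Σ (V → Fin k) λ c → ∀ u v → Adj G u v → c u ≢ c v

HasClique : ∀ {V} → Graph V → ℕ → Set
HasClique {V} G m = Σ (Fin m → V) λ f →
  Injective _≡_ _≡_ f × (∀ i j → i ≢ j → Adj G (f i) (f j))

IsChromaticNumber : ∀ {V} → Graph V → ℕ → Set
IsChromaticNumber G k = Colorable G k × (∀ m → Colorable G m → k ≤ m)

IsCliqueNumber : ∀ {V} → Graph V → ℕ → Set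
IsCliqueNumber G k = HasClique G k × (∀ m → HasClique G m → m ≤ k)

ChiEqOmega : ∀ {V} → Graph V → Set
ChiEqOmega G = ∃ λ k → IsChromaticNumber G k × IsCliqueNumber G k

Perfect : ∀ {n} → FinGraph n → Set
Perfect {n} G = (S : Subset n) → ChiEqOmega (induced G S)

module Submission where

-- Write G′ = G − E(G[I]).  The proof has four steps.
-- 1. Separator lemma (`linked-neighbours-adjacent`): two distinct neighbours of b that are
--    joined by a walk outside N[b] are adjacent, since otherwise a shortest such walk,
--    closed up through b, is a chordless cycle of length at least 4.
-- 2. Dirac's lemma (`simplicial-vertex`): every nonempty S contains a vertex that is
--    simplicial in G[S].  Induction on S: the neighbours of b next to the component of a
--    in G[S ∖ N[b]] form a clique by step 1.
-- 3. Colouring (`DeletedEdgesColouring`), for any graph with simplicial vertices as in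
--    step 2: every G′[S] has a proper colouring with k colours and a clique of size k.
--    Remove a simplicial vertex v, colour the rest, then give v the colour of a G-neighbour
--    in I, a colour missing around v, or a new colour that enlarges the clique.
-- 4. A k-colouring together with a k-clique certifies χ = ω (`χ≡ω`); so G′ is perfect.

open import Defs hiding (sym)
open import Data.Nat using (ℕ; zero; suc; _+_; _∸_; _≤_; _<_; z≤n; s≤s; _≤?_)
open import Data.Nat.Properties
  using (<⇒≱; ≰⇒>; ≤-refl; ≤-reflexive; ≤-trans; <-trans; <⇒≤; ≤-pred; ≤-<-trans; <-≤-trans;
         n<1+n; n≤1+n; <-cmp;
         +-suc; m≤n+m; m≤m+n; m∸n≤m; m∸n+n≡m; m+[n∸m]≡n; m+n≤o⇒m≤o∸n; +-monoˡ-<; ∸-monoʳ-<;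
         m<n⇒0<n∸m; m≤n⇒m<n∨m≡n; ≤∧≢⇒<; n≢0⇒n>0)
  renaming (_≟_ to _≟ℕ_)
open import Data.Nat.Induction using (<-wellFounded)
open import Induction.WellFounded using (Acc; acc)
open import Data.Fin using (Fin; zero; suc; toℕ; fromℕ<)
open import Data.Fin.Properties using (_≟_; any?; toℕ-fromℕ<; toℕ-injective; toℕ<n; injective⇒≤)
open import Function.Definitions using (Injective)
open import Data.Fin.Subset using (Subset; _∈_; _∉_; _⊂_; _⊃_; _∪_; ⁅_⁆)
open import Data.Fin.Subset.Properties
  using (_∈?_; nonempty?; x∈p∪q⁺; x∈p∪q⁻; x∈⁅x⁆; x∈⁅y⁆⇒x≡y)
open import Data.Fin.Subset.Induction using (⊂-wellFounded; ⊃-wellFounded)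
open import Data.Vec using (lookup; tabulate)
open import Data.Vec.Properties using (lookup∘tabulate; []=⇒lookup; lookup⇒[]=)
open import Data.Bool using (true; false; _∧_; not)
import Data.Bool.Properties as Bool
open import Data.Product using (∃; ∃₂; _×_; _,_; proj₁; proj₂)
open import Data.Sum using (_⊎_; inj₁; inj₂; [_,_]′)
open import Data.Empty using (⊥; ⊥-elim)
open import Relation.Nullary using (¬_; Dec; yes; no; does)
open import Relation.Nullary.Decidable using (dec-true; ¬?; _×-dec_; _⊎-dec_; decidable-stable)
open import Relation.Binary.PropositionalEquality
open import Relation.Binary.Definitions using (tri<; tri≈; tri>)
open import Function using (_∘_)

open Graph using () renaming (sym to adj-sym)

-- `glue l f h` follows the sequence f up to index l and h afterwards; walks are
-- shortened and closed into cycles by glueing sequences of vertices.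
glue : {A : Set} → ℕ → (ℕ → A) → (ℕ → A) → ℕ → A
glue l f h t with t ≤? l
... | yes _ = f t
... | no _  = h t

glue-≤ : ∀ {A : Set} l (f h : ℕ → A) {t} → t ≤ l → glue l f h t ≡ f t
glue-≤ l f h {t} t≤l with t ≤? l
... | yes _  = refl
... | no t≰l = ⊥-elim (t≰l t≤l)

glue-> : ∀ {A : Set} l (f h : ℕ → A) {t} → l < t → glue l f h t ≡ h t
glue-> l f h {t} l<t with t ≤? l
... | yes t≤l = ⊥-elim (<⇒≱ l<t t≤l)
... | no _    = refl

glue-split : ∀ {A : Set} (P : A → Set) l (f h : ℕ → A) t →
             (t ≤ l → P (f t)) → (l < t → P (h t)) → P (glue l f h t)
glue-split P l f h t pf ph with t ≤? l
... | yes t≤l = pf t≤l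
... | no t≰l  = ph (≰⇒> t≰l)

⟦_⟧ : ∀ {n} {P : Fin n → Set} → (∀ x → Dec (P x)) → Subset n
⟦ P? ⟧ = tabulate (λ x → does (P? x))

∈⟦⟧⁺ : ∀ {n} {P : Fin n → Set} (P? : ∀ x → Dec (P x)) {x} → P x → x ∈ ⟦ P? ⟧
∈⟦⟧⁺ P? {x} px = lookup⇒[]= x _ (trans (lookup∘tabulate _ x) (dec-true (P? x) px))

∈⟦⟧⁻ : ∀ {n} {P : Fin n → Set} (P? : ∀ x → Dec (P x)) {x} → x ∈ ⟦ P? ⟧ → P x
∈⟦⟧⁻ P? {x} x∈ with P? x | trans (sym (lookup∘tabulate (λ y → does (P? y)) x)) ([]=⇒lookup x∈)
... | yes px | _ = px
... | no _   | ()

remaining? : ∀ {n} (S : Subset n) (v : Fin n) x → Dec (x ∈ S × x ≢ v)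
remaining? S v x = x ∈? S ×-dec ¬? (x ≟ v)

_∖_ : ∀ {n} → Subset n → Fin n → Subset n
S ∖ v = ⟦ remaining? S v ⟧

module _ {n} {S : Subset n} {v : Fin n} where

  ∖⇒∈ : ∀ {x} → x ∈ S ∖ v → x ∈ S
  ∖⇒∈ = proj₁ ∘ ∈⟦⟧⁻ (remaining? S v)

  ∖⇒≢ : ∀ {x} → x ∈ S ∖ v → x ≢ v
  ∖⇒≢ = proj₂ ∘ ∈⟦⟧⁻ (remaining? S v)

  ∖-split : ∀ {x} → x ∈ S → x ≡ v ⊎ x ∈ S ∖ v
  ∖-split {x} x∈S with x ≟ v
  ... | yes x≡v = inj₁ x≡v
  ... | no x≢v  = inj₂ (∈⟦⟧⁺ (remaining? S v) (x∈S , x≢v))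

  ∖-⊂ : v ∈ S → S ∖ v ⊂ S
  ∖-⊂ v∈S = ∖⇒∈ , v , v∈S , (λ v∈S∖v → ∖⇒≢ v∈S∖v refl)

adjacent-injective : ∀ {V : Set} (H : Graph V) {m} {f : Fin m → V} →
                     (∀ i j → i ≢ j → Adj H (f i) (f j)) → Injective _≡_ _≡_ f
adjacent-injective H {f = f} f-adj {i} {j} fi≡fj =
  decidable-stable (i ≟ j) λ i≢j →
    Bool.not-¬ (irref H (f j)) (subst (λ x → Adj H x (f j)) fi≡fj (f-adj i j i≢j))

-- A clique of size m and a proper k-colouring force m ≤ k: the clique gets distinct colours.
clique≤colours : ∀ {V : Set} (H : Graph V) {m k} → HasClique H m → Colorable H k → m ≤ k
clique≤colours H (f , _ , f-adj) (c , c-proper) =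
  injective⇒≤ (λ {i} {j} ci≡cj → decidable-stable (i ≟ j) (λ i≢j → c-proper _ _ (f-adj i j i≢j) ci≡cj))

χ≡ω : ∀ {V : Set} (H : Graph V) {k} → Colorable H k → HasClique H k → ChiEqOmega H
χ≡ω H {k} colouring clique =
  k , (colouring , λ _ colouring′ → clique≤colours H clique colouring′) ,
      (clique , λ _ clique′ → clique≤colours H clique′ colouring)

module Notation {n : ℕ} (G : FinGraph n) where

  infix 4 _~_
  _~_ : Fin n → Fin n → Set
  x ~ y = Adj G x y

  _~?_ : ∀ x y → Dec (x ~ y)
  x ~? y = adj G x y Bool.≟ true

  ~-sym : ∀ {x y} → x ~ y → y ~ x
  ~-sym {x} {y} x~y = trans (adj-sym G y x) x~y

  ~-irrefl : ∀ {x y} → x ~ y → x ≢ y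
  ~-irrefl {x} x~x refl = Bool.not-¬ (irref G x) x~x

  Far : Fin n → Fin n → Set
  Far b x = x ≢ b × ¬ x ~ b

  far? : ∀ b x → Dec (Far b x)
  far? b x = ¬? (x ≟ b) ×-dec ¬? (x ~? b)

  Simplicial : Subset n → Fin n → Set
  Simplicial S x = x ∈ S × (∀ {y z} → y ∈ S → z ∈ S → x ~ y → x ~ z → y ≢ z → y ~ z)

  Joined : Subset n → Subset n → Set
  Joined P Q = ∀ {y z} → y ∈ P → z ∈ Q → y ≢ z → y ~ z

  joined-or-gap : ∀ P Q → Joined P Q ⊎ ∃₂ λ y z → y ∈ P × z ∈ Q × Far y z
  joined-or-gap P Q with any? (λ y → any? (λ z → y ∈? P ×-dec z ∈? Q ×-dec far? y z))
  ... | yes (y , z , gap) = inj₂ (y , z , gap)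
  ... | no none = inj₁ λ {y} {z} y∈P z∈Q y≢z →
    decidable-stable (y ~? z) λ y≁z →
      none (y , z , y∈P , z∈Q , y≢z ∘ sym , y≁z ∘ ~-sym)

  data Walk (T : Subset n) : Fin n → Fin n → Set where
    stay : ∀ {x} → x ∈ T → Walk T x x
    step : ∀ {x y z} → x ∈ T → x ~ y → Walk T y z → Walk T x z

  module _ {T : Subset n} where

    head∈ : ∀ {x y} → Walk T x y → x ∈ T
    head∈ (stay x∈T)     = x∈T
    head∈ (step x∈T _ _) = x∈T

    _++_ : ∀ {x y z} → Walk T x y → Walk T y z → Walk T x z
    stay _       ++ w′ = w′
    step x∈T e w ++ w′ = step x∈T e (w ++ w′)

    reverse : ∀ {x y} → Walk T x y → Walk T y x
    reverse (stay x∈T)     = stay x∈T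
    reverse (step x∈T e w) = reverse w ++ step (head∈ w) (~-sym e) (stay x∈T)

    length : ∀ {x y} → Walk T x y → ℕ
    length (stay _)     = 0
    length (step _ _ w) = suc (length w)

    -- The t-th vertex of a walk (its last vertex for t beyond the length).
    vertex : ∀ {x y} → Walk T x y → ℕ → Fin n
    vertex {x} (stay _)     _       = x
    vertex {x} (step _ _ w) zero    = x
    vertex     (step _ _ w) (suc t) = vertex w t

    vertex-0 : ∀ {x y} (w : Walk T x y) → vertex w 0 ≡ x
    vertex-0 (stay _)     = refl
    vertex-0 (step _ _ _) = refl

    vertex-end : ∀ {x y} (w : Walk T x y) → vertex w (length w) ≡ y
    vertex-end (stay _)     = refl
    vertex-end (step _ _ w) = vertex-end w

    vertex-∈ : ∀ {x y} (w : Walk T x y) t → vertex w t ∈ T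
    vertex-∈ (stay x∈T)     _       = x∈T
    vertex-∈ (step x∈T _ _) zero    = x∈T
    vertex-∈ (step _ _ w)   (suc t) = vertex-∈ w t

    vertex-~ : ∀ {x y} (w : Walk T x y) {t} → t < length w → vertex w t ~ vertex w (suc t)
    vertex-~ (step _ e w) {zero}  _         = subst (_ ~_) (sym (vertex-0 w)) e
    vertex-~ (step _ _ w) {suc t} (s≤s t<l) = vertex-~ w t<l

module AvoidingWalks {n : ℕ} (G : FinGraph n) where
  open Notation G

  record AvoidingWalk (b c₁ c₂ : Fin n) (m : ℕ) : Set where
    field
      at     : ℕ → Fin n
      at-0   : at 0 ≡ c₁
      at-m   : at m ≡ c₂
      at-~   : ∀ {t} → t < m → at t ~ at (suc t)
      at-far : ∀ {t} → 0 < t → t < m → Far b (at t)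
  open AvoidingWalk

  module _ {b c₁ c₂ : Fin n} where

    skip : ∀ {m} (W : AvoidingWalk b c₁ c₂ m) i d → 0 < d → i + suc d ≤ m →
           at W i ~ at W (i + suc d) → AvoidingWalk b c₁ c₂ (m ∸ d)
    skip {m} W i d 0<d i+1+d≤m wi~wj = record
      { at = at′ ; at-0 = trans (before z≤n) (at-0 W) ; at-m = end ; at-~ = steps ; at-far = far }
      where
      at′ : ℕ → Fin n
      at′ = glue i (at W) (λ t → at W (t + d))
      before : ∀ {t} → t ≤ i → at′ t ≡ at W t
      before = glue-≤ i (at W) (λ t → at W (t + d))
      after : ∀ {t} → i < t → at′ t ≡ at W (t + d)
      after = glue-> i (at W) (λ t → at W (t + d))
      1+i+d≤m : suc i + d ≤ m
      1+i+d≤m = subst (_≤ m) (+-suc i d) i+1+d≤m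
      d≤m : d ≤ m
      d≤m = ≤-trans (m≤n+m d (suc i)) 1+i+d≤m
      i<m∸d : i < m ∸ d
      i<m∸d = m+n≤o⇒m≤o∸n (suc i) 1+i+d≤m
      below : ∀ {t} → t < i → t < m
      below t<i = <-trans t<i (<-≤-trans i<m∸d (m∸n≤m m d))
      shifted : ∀ {t} → t < m ∸ d → t + d < m
      shifted t<m∸d = subst (_ <_) (m∸n+n≡m d≤m) (+-monoˡ-< d t<m∸d)
      end : at′ (m ∸ d) ≡ c₂
      end = trans (after i<m∸d) (trans (cong (at W) (m∸n+n≡m d≤m)) (at-m W))
      steps : ∀ {t} → t < m ∸ d → at′ t ~ at′ (suc t)
      steps {t} t<m∸d with <-cmp t i
      ... | tri< t<i _ _ =
        subst₂ _~_ (sym (before (<⇒≤ t<i))) (sym (before t<i)) (at-~ W (below t<i))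
      ... | tri≈ _ refl _ =
        subst₂ _~_ (sym (before ≤-refl)) (trans (cong (at W) (+-suc t d)) (sym (after (n<1+n t)))) wi~wj
      ... | tri> _ _ i<t =
        subst₂ _~_ (sym (after i<t)) (sym (after (<-trans i<t (n<1+n t)))) (at-~ W (shifted t<m∸d))
      far : ∀ {t} → 0 < t → t < m ∸ d → Far b (at′ t)
      far {t} 0<t t<m∸d = glue-split (Far b) i _ _ t
        (λ t≤i → at-far W 0<t (≤-<-trans t≤i (<-≤-trans i<m∸d (m∸n≤m m d))))
        (λ _ → at-far W (<-≤-trans 0<t (m≤m+n t d)) (shifted t<m∸d))

    truncate : ∀ {m} (W : AvoidingWalk b c₁ c₂ m) i → i < m → at W i ≡ c₂ → AvoidingWalk b c₁ c₂ i
    truncate W i i<m wi≡c₂ = record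
      { at = at W ; at-0 = at-0 W ; at-m = wi≡c₂
      ; at-~ = λ t<i → at-~ W (<-trans t<i i<m)
      ; at-far = λ 0<t t<i → at-far W 0<t (<-trans t<i i<m) }

    Shortcut : ∀ {m} → AvoidingWalk b c₁ c₂ m → ℕ → ℕ → Set
    Shortcut {m} W i j =
      suc (suc i) ≤ j × j ≤ m × ¬ (i ≡ 0 × j ≡ m) × (at W i ~ at W j ⊎ at W i ≡ at W j)

    shortcut? : ∀ {m} (W : AvoidingWalk b c₁ c₂ m) i j → Dec (Shortcut W i j)
    shortcut? {m} W i j =
      suc (suc i) ≤? j ×-dec j ≤? m ×-dec ¬? ((i ≟ℕ 0) ×-dec (j ≟ℕ m)) ×-dec
      (at W i ~? at W j ⊎-dec at W i ≟ at W j)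

    Tight : ∀ {m} → AvoidingWalk b c₁ c₂ m → Set
    Tight W = ∀ i j → ¬ Shortcut W i j

    shortcut-or-tight : ∀ {m} (W : AvoidingWalk b c₁ c₂ m) → (∃₂ λ i j → Shortcut W i j) ⊎ Tight W
    shortcut-or-tight {m} W
      with any? (λ (i : Fin (suc m)) → any? (λ (j : Fin (suc m)) → shortcut? W (toℕ i) (toℕ j)))
    ... | yes (i , j , s) = inj₁ (toℕ i , toℕ j , s)
    ... | no none         = inj₂ λ i j s → none (as-Fin s)
      where
      as-Fin : ∀ {i j} → Shortcut W i j →
               ∃ λ (i′ : Fin (suc m)) → ∃ λ (j′ : Fin (suc m)) → Shortcut W (toℕ i′) (toℕ j′)
      as-Fin {i} {j} s@(i+2≤j , j≤m , _) =
        fromℕ< (s≤s i≤m) , fromℕ< (s≤s j≤m) ,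
        subst₂ (Shortcut W) (sym (toℕ-fromℕ< (s≤s i≤m))) (sym (toℕ-fromℕ< (s≤s j≤m))) s
        where
        i≤m : i ≤ m
        i≤m = ≤-trans (n≤1+n i) (≤-trans (<⇒≤ i+2≤j) j≤m)

    skip-between : ∀ {m} (W : AvoidingWalk b c₁ c₂ m) {i j} → suc (suc i) ≤ j → j ≤ m →
                   at W i ~ at W j → ∃ λ m′ → m′ < m × AvoidingWalk b c₁ c₂ m′
    skip-between {m} W {i} {j} i+2≤j j≤m wi~wj =
      m ∸ d , ∸-monoʳ-< {m} {d} {0} 0<d d≤m ,
      skip W i d 0<d i+1+d≤m (subst (λ k → at W i ~ at W k) (sym i+1+d≡j) wi~wj)
      where
      d : ℕ
      d = j ∸ suc i
      i+1+d≡j : i + suc d ≡ j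
      i+1+d≡j = trans (+-suc i d) (m+[n∸m]≡n (<⇒≤ i+2≤j))
      0<d : 0 < d
      0<d = m<n⇒0<n∸m i+2≤j
      i+1+d≤m : i + suc d ≤ m
      i+1+d≤m = subst (_≤ m) (sym i+1+d≡j) j≤m
      d≤m : d ≤ m
      d≤m = ≤-trans (m≤n+m d (suc i)) (subst (_≤ m) (+-suc i d) i+1+d≤m)

    -- Every shortcut yields a strictly shorter avoiding walk.  A repetition wᵢ = wⱼ is
    -- handled through the edge wᵢ ~ wⱼ₊₁, or by stopping at i when j is the end.
    shorten : ∀ {m} (W : AvoidingWalk b c₁ c₂ m) {i j} → Shortcut W i j →
              ∃ λ m′ → m′ < m × AvoidingWalk b c₁ c₂ m′
    shorten W (i+2≤j , j≤m , _ , inj₁ wi~wj) = skip-between W i+2≤j j≤m wi~wj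
    shorten W {i} {j} (i+2≤j , j≤m , _ , inj₂ wi≡wj) with m≤n⇒m<n∨m≡n j≤m
    ... | inj₁ j<m  =
      skip-between W (≤-trans i+2≤j (n≤1+n j)) j<m (subst (_~ at W (suc j)) (sym wi≡wj) (at-~ W j<m))
    ... | inj₂ refl = i , <-trans (n<1+n i) i+2≤j , truncate W i (<-trans (n<1+n i) i+2≤j) (trans wi≡wj (at-m W))

  module _ (chordal : Chordal G) {b c₁ c₂ : Fin n}
           (c₁~b : c₁ ~ b) (c₂~b : c₂ ~ b) (c₁≢c₂ : c₁ ≢ c₂) (c₁≁c₂ : ¬ c₁ ~ c₂) where

    -- A tight avoiding walk w₀ ⋯ w_M (M ≥ 2) followed by b is a chordless cycle of
    -- length M + 2 ≥ 4, which a chordal graph cannot contain.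
    module TightCycle {m} (W : AvoidingWalk b c₁ c₂ (suc (suc m))) (tight : Tight W) where

      M : ℕ
      M = suc (suc m)

      walk≢b : ∀ {p} → p ≤ M → at W p ≢ b
      walk≢b {p} p≤M with p ≟ℕ 0 | p ≟ℕ M
      ... | yes refl | _        = ~-irrefl (subst (_~ b) (sym (at-0 W)) c₁~b)
      ... | no _     | yes refl = ~-irrefl (subst (_~ b) (sym (at-m W)) c₂~b)
      ... | no p≢0   | no p≢M   = proj₁ (at-far W (n≢0⇒n>0 p≢0) (≤∧≢⇒< p≤M p≢M))

      only-consecutive : ∀ {p q} → p < q → q ≤ M → at W p ~ at W q ⊎ at W p ≡ at W q → q ≡ suc p
      only-consecutive {p} {q} p<q q≤M related with q ≟ℕ suc p
      ... | yes q≡1+p = q≡1+p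
      ... | no q≢1+p  = ⊥-elim (tight p q (≤∧≢⇒< p<q (q≢1+p ∘ sym) , q≤M , not-ends , related))
        where
        not-ends : ¬ (p ≡ 0 × q ≡ M)
        not-ends (p≡0 , q≡M) =
          [ c₁≁c₂ ∘ subst₂ _~_ wp≡c₁ wq≡c₂ , (λ e → c₁≢c₂ (trans (sym wp≡c₁) (trans e wq≡c₂))) ]′
            related
          where
          wp≡c₁ = trans (cong (at W) p≡0) (at-0 W)
          wq≡c₂ = trans (cong (at W) q≡M) (at-m W)

      cyc : ℕ → Fin n
      cyc = glue M (at W) (λ _ → b)

      cyc-walk : ∀ {p} → p ≤ M → cyc p ≡ at W p
      cyc-walk = glue-≤ M (at W) (λ _ → b)

      cyc-b : cyc (suc M) ≡ b
      cyc-b = glue-> M (at W) (λ _ → b) ≤-refl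

      -- The cycle is simple: a repeated walk vertex would sit at consecutive positions.
      cyc-distinct : ∀ {p q} → p < q → q ≤ suc M → cyc p ≢ cyc q
      cyc-distinct {p} {q} p<q q≤1+M cp≡cq with m≤n⇒m<n∨m≡n q≤1+M
      ... | inj₂ refl = walk≢b (≤-pred p<q) (trans (sym (cyc-walk (≤-pred p<q))) (trans cp≡cq cyc-b))
      ... | inj₁ q<1+M = ~-irrefl (at-~ W p<M) (trans wp≡wq (cong (at W) q≡1+p))
        where
        q≤M = ≤-pred q<1+M
        wp≡wq = trans (sym (cyc-walk (≤-trans (<⇒≤ p<q) q≤M))) (trans cp≡cq (cyc-walk q≤M))
        q≡1+p = only-consecutive p<q q≤M (inj₂ wp≡wq)
        p<M = subst (_≤ M) q≡1+p q≤M

      cyc-injective : ∀ {p q} → p ≤ suc M → q ≤ suc M → cyc p ≡ cyc q → p ≡ q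
      cyc-injective {p} {q} p≤ q≤ cp≡cq with <-cmp p q
      ... | tri< p<q _ _ = ⊥-elim (cyc-distinct p<q q≤ cp≡cq)
      ... | tri≈ _ p≡q _ = p≡q
      ... | tri> _ _ q<p = ⊥-elim (cyc-distinct q<p p≤ (sym cp≡cq))

      -- Cyclic successor on the positions 0 … M + 1 (this is `Consec` read on ℕ).
      Next : ℕ → ℕ → Set
      Next p q = q ≡ suc p ⊎ (p ≡ suc M × q ≡ 0)

      cyc-edge : ∀ {p q} → q ≤ suc M → Next p q → cyc p ~ cyc q
      cyc-edge {p} q≤1+M (inj₁ refl) with m≤n⇒m<n∨m≡n (≤-pred q≤1+M)
      ... | inj₁ p<M  = subst₂ _~_ (sym (cyc-walk (<⇒≤ p<M))) (sym (cyc-walk p<M)) (at-~ W p<M)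
      ... | inj₂ refl = subst₂ _~_ (sym (trans (cyc-walk ≤-refl) (at-m W))) (sym cyc-b) c₂~b
      cyc-edge _ (inj₂ (refl , refl)) = subst₂ _~_ (sym cyc-b) (sym (trans (cyc-walk z≤n) (at-0 W))) (~-sym c₁~b)

      -- The cycle has no chord: b only sees the ends of the walk, and the walk is tight.
      cyc-chordless : ∀ {p q} → p < q → q ≤ suc M → ¬ Next p q → ¬ Next q p → ¬ cyc p ~ cyc q
      cyc-chordless {p} {q} p<q q≤1+M ¬pq ¬qp cp~cq with m≤n⇒m<n∨m≡n q≤1+M
      ... | inj₁ q<1+M = ¬pq (inj₁ (only-consecutive p<q q≤M (inj₁ wp~wq)))
        where
        q≤M = ≤-pred q<1+M
        wp~wq = subst₂ _~_ (cyc-walk (≤-trans (<⇒≤ p<q) q≤M)) (cyc-walk q≤M) cp~cq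
      ... | inj₂ refl with p ≟ℕ 0 | p ≟ℕ M
      ...   | yes refl | _        = ¬qp (inj₂ (refl , refl))
      ...   | no _     | yes refl = ¬pq (inj₁ refl)
      ...   | no p≢0   | no p≢M   =
        proj₂ (at-far W (n≢0⇒n>0 p≢0) (≤∧≢⇒< (≤-pred p<q) p≢M))
              (subst₂ _~_ (cyc-walk (≤-pred p<q)) cyc-b cp~cq)

      position≤ : (i : Fin (suc (suc M))) → toℕ i ≤ suc M
      position≤ i = ≤-pred (toℕ<n i)

      cycle : Cycle G (suc (suc M))
      cycle = record
        { vtx      = λ i → cyc (toℕ i)
        ; distinct = λ {i} {j} eq → toℕ-injective (cyc-injective (position≤ i) (position≤ j) eq)
        ; edges    = λ i j → cyc-edge (position≤ j) }

      impossible : ⊥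
      impossible with chordal _ (s≤s (s≤s (s≤s (s≤s z≤n)))) cycle
      ... | i , j , i≢j , ¬ij , ¬ji , i~j with <-cmp (toℕ i) (toℕ j)
      ...   | tri< i<j _ _ = cyc-chordless i<j (position≤ j) ¬ij ¬ji i~j
      ...   | tri≈ _ i≡j _ = i≢j (toℕ-injective i≡j)
      ...   | tri> _ _ j<i = cyc-chordless j<i (position≤ i) ¬ji ¬ij (~-sym i~j)

    -- In a chordal graph no avoiding walk joins c₁ to c₂: a shortest one would be tight.
    no-avoiding-walk : ∀ {m} → AvoidingWalk b c₁ c₂ m → ⊥
    no-avoiding-walk {m} = go m (<-wellFounded m)
      where
      go : ∀ m → Acc _<_ m → AvoidingWalk b c₁ c₂ m → ⊥
      go zero          _             W = c₁≢c₂ (trans (sym (at-0 W)) (at-m W))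
      go (suc zero)    _             W = c₁≁c₂ (subst₂ _~_ (at-0 W) (at-m W) (at-~ W (s≤s z≤n)))
      go (suc (suc m)) (acc shorter) W with shortcut-or-tight W
      ... | inj₂ tight           = TightCycle.impossible W tight
      ... | inj₁ (_ , _ , short) with shorten W short
      ...   | m′ , m′<m , W′     = go m′ (shorter m′<m) W′

  linked-neighbours-adjacent :
    Chordal G → ∀ {T : Subset n} {b c₁ c₂ u₁ u₂} → (∀ {x} → x ∈ T → Far b x) →
    c₁ ~ b → c₂ ~ b → c₁ ≢ c₂ → c₁ ~ u₁ → Walk T u₁ u₂ → u₂ ~ c₂ → c₁ ~ c₂
  linked-neighbours-adjacent chordal {T} {b} {c₁} {c₂} T-far c₁~b c₂~b c₁≢c₂ c₁~u₁ w u₂~c₂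
    with c₁ ~? c₂
  ... | yes c₁~c₂ = c₁~c₂
  ... | no c₁≁c₂  = ⊥-elim (no-avoiding-walk chordal c₁~b c₂~b c₁≢c₂ c₁≁c₂ through-w)
    where
    L : ℕ
    L = length w
    inner : ℕ → Fin n
    inner = glue L (vertex w) (λ _ → c₂)
    on-w : ∀ {t} → t ≤ L → inner t ≡ vertex w t
    on-w = glue-≤ L (vertex w) (λ _ → c₂)
    after-w : inner (suc L) ≡ c₂
    after-w = glue-> L (vertex w) (λ _ → c₂) ≤-refl
    path : ℕ → Fin n
    path zero    = c₁
    path (suc t) = inner t
    steps : ∀ {t} → t < suc (suc L) → path t ~ path (suc t)
    steps {zero}  _              = subst (c₁ ~_) (sym (trans (on-w z≤n) (vertex-0 w))) c₁~u₁
    steps {suc t} (s≤s t<1+L) with m≤n⇒m<n∨m≡n (≤-pred t<1+L)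
    ... | inj₁ t<L  = subst₂ _~_ (sym (on-w (<⇒≤ t<L))) (sym (on-w t<L)) (vertex-~ w t<L)
    ... | inj₂ refl = subst₂ _~_ (sym (trans (on-w ≤-refl) (vertex-end w))) (sym after-w) u₂~c₂
    through-w : AvoidingWalk b c₁ c₂ (suc (suc L))
    through-w = record
      { at = path ; at-0 = refl ; at-m = after-w ; at-~ = steps
      ; at-far = λ { {suc t} _ (s≤s t<1+L) → subst (Far b) (sym (on-w (≤-pred t<1+L))) (T-far (vertex-∈ w t)) } }

module SimplicialVertices {n : ℕ} (G : FinGraph n) (chordal : Chordal G) where
  open Notation G
  open AvoidingWalks G using (linked-neighbours-adjacent)

  record Component (T : Subset n) (a : Fin n) : Set where
    field
      members : Subset n
      a∈      : a ∈ members
      linked  : ∀ {x} → x ∈ members → Walk T x a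
      closed  : ∀ {x y} → x ∈ members → y ∈ T → x ~ y → y ∈ members

  component : ∀ {T : Subset n} {a} → a ∈ T → Component T a
  component {T} {a} a∈T =
    grow ⁅ a ⁆ (⊃-wellFounded _) (x∈⁅x⁆ a) (λ x∈⁅a⁆ → at-a x∈⁅a⁆ (stay a∈T))
    where
    at-a : ∀ {x y} → x ∈ ⁅ y ⁆ → Walk T y a → Walk T x a
    at-a {x} {y} x∈⁅y⁆ = subst (λ z → Walk T z a) (sym (x∈⁅y⁆⇒x≡y y x∈⁅y⁆))

    grow : ∀ R → Acc _⊃_ R → a ∈ R → (∀ {x} → x ∈ R → Walk T x a) → Component T a
    grow R (acc larger) a∈R linked
      with any? (λ x → any? (λ y → x ∈? R ×-dec y ∈? T ×-dec x ~? y ×-dec ¬? (y ∈? R)))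
    ... | no no-exit = record
      { members = R ; a∈ = a∈R ; linked = linked
      ; closed = λ {x} {y} x∈R y∈T x~y →
          decidable-stable (y ∈? R) (λ y∉R → no-exit (x , y , x∈R , y∈T , x~y , y∉R)) }
    ... | yes (x , y , x∈R , y∈T , x~y , y∉R) =
      grow (R ∪ ⁅ y ⁆) (larger R⊂R∪y) (x∈p∪q⁺ (inj₁ a∈R)) linked′
      where
      R⊂R∪y : R ⊂ R ∪ ⁅ y ⁆
      R⊂R∪y = (λ z∈R → x∈p∪q⁺ (inj₁ z∈R)) , y , x∈p∪q⁺ (inj₂ (x∈⁅x⁆ y)) , y∉R
      linked′ : ∀ {z} → z ∈ R ∪ ⁅ y ⁆ → Walk T z a
      linked′ {z} z∈ =
        [ linked , (λ z∈⁅y⁆ → at-a z∈⁅y⁆ (step y∈T (~-sym x~y) (linked x∈R))) ]′ (x∈p∪q⁻ R ⁅ y ⁆ z∈)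

  DiracFor : Subset n → Set
  DiracFor S = ∀ {a b} → a ∈ S → b ∈ S → Far b a → ∃ λ x → Simplicial S x × Far b x

  -- Let A be the component of a in G[S ∖ N[b]] and C the set of
  -- neighbours of b in S adjacent to A.  C is a clique (separator lemma), and every
  -- simplicial vertex of G[A ∪ C] lying in A is simplicial in G[S]; such a vertex is
  -- found in A ∪ C ⊂ S by induction.
  module DiracStep (S : Subset n) (induction : ∀ {S₁} → S₁ ⊂ S → DiracFor S₁)
                   {a b} (a∈S : a ∈ S) (b∈S : b ∈ S) (a-far : Far b a) where

    T? : ∀ x → Dec (x ∈ S × Far b x)
    T? x = x ∈? S ×-dec far? b x

    T : Subset n
    T = ⟦ T? ⟧

    open Component (component (∈⟦⟧⁺ T? (a∈S , a-far))) renaming (members to A; a∈ to a∈A)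

    A⊆S∖N[b] : ∀ {x} → x ∈ A → x ∈ S × Far b x
    A⊆S∖N[b] x∈A = ∈⟦⟧⁻ T? (head∈ (linked x∈A))

    C? : ∀ y → Dec (y ∈ S × y ~ b × ∃ λ x → x ∈ A × x ~ y)
    C? y = y ∈? S ×-dec y ~? b ×-dec any? (λ x → x ∈? A ×-dec x ~? y)

    C : Subset n
    C = ⟦ C? ⟧

    S₁ : Subset n
    S₁ = A ∪ C

    S₁⊂S : S₁ ⊂ S
    S₁⊂S = S₁⊆S , b , b∈S , b∉S₁
      where
      S₁⊆S : ∀ {x} → x ∈ S₁ → x ∈ S
      S₁⊆S x∈S₁ = [ proj₁ ∘ A⊆S∖N[b] , proj₁ ∘ ∈⟦⟧⁻ C? ]′ (x∈p∪q⁻ A C x∈S₁)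
      b∉S₁ : b ∉ S₁
      b∉S₁ b∈S₁ =
        [ (λ b∈A → proj₁ (proj₂ (A⊆S∖N[b] b∈A)) refl) , (λ b∈C → ~-irrefl (proj₁ (proj₂ (∈⟦⟧⁻ C? b∈C))) refl) ]′
          (x∈p∪q⁻ A C b∈S₁)

    neighbours-of-A : ∀ {x y} → x ∈ A → y ∈ S → x ~ y → y ∈ S₁
    neighbours-of-A {x} {y} x∈A y∈S x~y with y ≟ b | y ~? b
    ... | yes refl | _        = ⊥-elim (proj₂ (proj₂ (A⊆S∖N[b] x∈A)) x~y)
    ... | no _     | yes y~b  = x∈p∪q⁺ (inj₂ (∈⟦⟧⁺ C? (y∈S , y~b , x , x∈A , x~y)))
    ... | no y≢b   | no y≁b   = x∈p∪q⁺ (inj₁ (closed x∈A (∈⟦⟧⁺ T? (y∈S , y≢b , y≁b)) x~y))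

    -- C is a clique: two of its vertices are linked through A, which avoids N[b].
    C-clique : Joined C C
    C-clique y∈C z∈C y≢z with ∈⟦⟧⁻ C? y∈C | ∈⟦⟧⁻ C? z∈C
    ... | _ , y~b , u , u∈A , u~y | _ , z~b , v , v∈A , v~z =
      linked-neighbours-adjacent chordal (proj₂ ∘ ∈⟦⟧⁻ T?) y~b z~b y≢z (~-sym u~y)
        (linked u∈A ++ reverse (linked v∈A)) v~z

    lift : ∀ {x} → x ∈ A → Simplicial S₁ x → Simplicial S x × Far b x
    lift x∈A (_ , simplicial) =
      (proj₁ (A⊆S∖N[b] x∈A) ,
       λ y∈S z∈S x~y x~z → simplicial (neighbours-of-A x∈A y∈S x~y) (neighbours-of-A x∈A z∈S x~z) x~y x~z) ,
      proj₂ (A⊆S∖N[b] x∈A)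

    lift-from-A : ∀ {b′} → (∀ {x} → x ∈ C → ¬ Far b′ x) →
                  (∃ λ x → Simplicial S₁ x × Far b′ x) → ∃ λ x → Simplicial S x × Far b x
    lift-from-A not-in-C (x , simplicial , x-far) =
      [ (λ x∈A → x , lift x∈A simplicial) , (λ x∈C → ⊥-elim (not-in-C x∈C x-far)) ]′
        (x∈p∪q⁻ A C (proj₁ simplicial))

    result : ∃ λ x → Simplicial S x × Far b x
    result with joined-or-gap S₁ S₁
    ... | inj₁ S₁-clique = a , lift a∈A (x∈p∪q⁺ (inj₁ a∈A) , λ y∈ z∈ _ _ → S₁-clique y∈ z∈)
    ... | inj₂ (y , z , y∈S₁ , z∈S₁ , z-far) with joined-or-gap C S₁
    ...   | inj₂ (c , w , c∈C , w∈S₁ , w-far) =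
      lift-from-A (λ x∈C x-far → proj₂ x-far (C-clique x∈C c∈C (proj₁ x-far)))
                  (induction S₁⊂S w∈S₁ (x∈p∪q⁺ (inj₂ c∈C)) w-far)
    ...   | inj₁ C-joined =
      lift-from-A (λ x∈C x-far → proj₂ x-far (C-joined x∈C y∈S₁ (proj₁ x-far)))
                  (induction S₁⊂S z∈S₁ y∈S₁ z-far)

  dirac : ∀ S → DiracFor S
  dirac S = go S (⊂-wellFounded S)
    where
    go : ∀ S → Acc _⊂_ S → DiracFor S
    go S (acc smaller) = DiracStep.result S (λ S₁⊂S → go _ (smaller S₁⊂S))

  simplicial-vertex : ∀ S {x} → x ∈ S → ∃ (Simplicial S)
  simplicial-vertex S {x} x∈S with joined-or-gap S S
  ... | inj₁ clique = x , x∈S , λ y∈ z∈ _ _ → clique y∈ z∈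
  ... | inj₂ (y , z , y∈S , z∈S , z-far) with dirac S z∈S y∈S z-far
  ...   | v , simplicial , _ = v , simplicial

module DeletedEdgesColouring {n : ℕ} (G : FinGraph n) (I : Subset n)
         (simplicial-vertex : ∀ S {x} → x ∈ S → ∃ (Notation.Simplicial G S)) where
  open Notation G

  G′ : FinGraph n
  G′ = deleteInsideEdges G I

  open Notation G′ using () renaming (_~_ to _~′_; ~-sym to ~′-sym; ~-irrefl to ~′-irrefl)

  ~′⇒~ : ∀ {x y} → x ~′ y → x ~ y
  ~′⇒~ = Bool.∧-conicalˡ _ _

  ~′-not-inside : ∀ {x y} → x ~′ y → x ∈ I → y ∈ I → ⊥
  ~′-not-inside {x} {y} x~′y x∈I y∈I =
    false≢true (subst (λ k → not k ≡ true) inside (Bool.∧-conicalʳ _ _ x~′y))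
    where
    inside : lookup I x ∧ lookup I y ≡ true
    inside = cong₂ _∧_ ([]=⇒lookup x∈I) ([]=⇒lookup y∈I)
    false≢true : false ≢ true
    false≢true ()

  ~⇒~′ : ∀ {x y} → x ~ y → ¬ (x ∈ I × y ∈ I) → x ~′ y
  ~⇒~′ {x} {y} x~y not-inside rewrite x~y with lookup I x in Ix | lookup I y in Iy
  ... | true  | true  = ⊥-elim (not-inside (lookup⇒[]= x I Ix , lookup⇒[]= y I Iy))
  ... | true  | false = refl
  ... | false | _     = refl

  -- The extra invariant (vertices of I adjacent in G share
  -- their colour) is what lets the induction reuse colours.
  record Colouring (S : Subset n) : Set where
    field
      colours    : ℕ
      colour     : Fin n → ℕ
      in-range   : ∀ {x} → x ∈ S → colour x < colours
      proper     : ∀ {x y} → x ∈ S → y ∈ S → x ~′ y → colour x ≢ colour y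
      I-uniform  : ∀ {x y} → x ∈ S → y ∈ S → x ∈ I → y ∈ I → x ~ y → colour x ≡ colour y
      clique     : Fin colours → Fin n
      clique⊆S   : ∀ i → clique i ∈ S
      clique-adj : ∀ {i j} → i ≢ j → clique i ~′ clique j

  empty-colouring : ∀ {S} → (∀ {x} → x ∉ S) → Colouring S
  empty-colouring x∉S = record
    { colours = 0 ; colour = λ _ → 0 ; in-range = ⊥-elim ∘ x∉S
    ; proper = λ x∈S → ⊥-elim (x∉S x∈S) ; I-uniform = λ x∈S → ⊥-elim (x∉S x∈S)
    ; clique = λ () ; clique⊆S = λ () ; clique-adj = λ {i} → ⊥-elim (Fin0 i) }
    where
    Fin0 : Fin 0 → ⊥
    Fin0 ()

  module Extend (S : Subset n) (v : Fin n) (v-simplicial : Simplicial S v) (R : Colouring (S ∖ v)) where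
    open Colouring R

    neighbours-adjacent : ∀ {u w} → u ∈ S ∖ v → w ∈ S ∖ v → v ~ u → v ~ w → u ≢ w → u ~ w
    neighbours-adjacent u∈ w∈ = proj₂ v-simplicial (∖⇒∈ u∈) (∖⇒∈ w∈)

    on-pairs : (P : Fin n → Fin n → Set) → (∀ {x y} → P x y → P y x) → P v v →
               (∀ {y} → y ∈ S ∖ v → P v y) → (∀ {x y} → x ∈ S ∖ v → y ∈ S ∖ v → P x y) →
               ∀ {x y} → x ∈ S → y ∈ S → P x y
    on-pairs P P-sym Pvv Pv- P-- x∈S y∈S with ∖-split {v = v} x∈S | ∖-split {v = v} y∈S
    ... | inj₁ refl | inj₁ refl = Pvv
    ... | inj₁ refl | inj₂ y∈   = Pv- y∈
    ... | inj₂ x∈   | inj₁ refl = P-sym (Pv- x∈)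
    ... | inj₂ x∈   | inj₂ y∈   = P-- x∈ y∈

    recolour : ℕ → Fin n → ℕ
    recolour c x with x ≟ v
    ... | yes _ = c
    ... | no _  = colour x

    recolour-v : ∀ c → recolour c v ≡ c
    recolour-v c with v ≟ v
    ... | yes _  = refl
    ... | no v≢v = ⊥-elim (v≢v refl)

    recolour-old : ∀ c {x} → x ∈ S ∖ v → recolour c x ≡ colour x
    recolour-old c {x} x∈ with x ≟ v
    ... | yes x≡v = ⊥-elim (∖⇒≢ x∈ x≡v)
    ... | no _    = refl

    Proper Uniform : ℕ → Fin n → Fin n → Set
    Proper c x y  = x ~′ y → recolour c x ≢ recolour c y
    Uniform c x y = x ∈ I → y ∈ I → x ~ y → recolour c x ≡ recolour c y

    recolour-proper : ∀ c → (∀ {y} → y ∈ S ∖ v → Proper c v y) →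
                      ∀ {x y} → x ∈ S → y ∈ S → Proper c x y
    recolour-proper c at-v = on-pairs (Proper c) flip-proper (λ v~′v → ⊥-elim (~′-irrefl v~′v refl)) at-v old
      where
      flip-proper : ∀ {x y} → Proper c x y → Proper c y x
      flip-proper p y~′x = p (~′-sym y~′x) ∘ sym
      old : ∀ {x y} → x ∈ S ∖ v → y ∈ S ∖ v → Proper c x y
      old x∈ y∈ x~′y eq = proper x∈ y∈ x~′y (trans (sym (recolour-old c x∈)) (trans eq (recolour-old c y∈)))

    recolour-uniform : ∀ c → (∀ {y} → y ∈ S ∖ v → Uniform c v y) →
                       ∀ {x y} → x ∈ S → y ∈ S → Uniform c x y
    recolour-uniform c at-v = on-pairs (Uniform c) flip-uniform (λ _ _ _ → refl) at-v old
      where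
      flip-uniform : ∀ {x y} → Uniform c x y → Uniform c y x
      flip-uniform u y∈I x∈I y~x = sym (u x∈I y∈I (~-sym y~x))
      old : ∀ {x y} → x ∈ S ∖ v → y ∈ S ∖ v → Uniform c x y
      old x∈ y∈ x∈I y∈I x~y =
        trans (recolour-old c x∈) (trans (I-uniform x∈ y∈ x∈I y∈I x~y) (sym (recolour-old c y∈)))

    reuse : ∀ c → c < colours →
            (∀ {u} → u ∈ S ∖ v → v ~′ u → colour u ≢ c) →
            (∀ {u} → u ∈ S ∖ v → v ∈ I → u ∈ I → v ~ u → colour u ≡ c) → Colouring S
    reuse c c<colours avoids agrees = record
      { colours = colours ; colour = recolour c ; in-range = range
      ; proper = recolour-proper c at-v-proper ; I-uniform = recolour-uniform c at-v-uniform
      ; clique = clique ; clique⊆S = ∖⇒∈ ∘ clique⊆S ; clique-adj = clique-adj }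
      where
      range : ∀ {x} → x ∈ S → recolour c x < colours
      range x∈S with ∖-split {v = v} x∈S
      ... | inj₁ refl = subst (_< colours) (sym (recolour-v c)) c<colours
      ... | inj₂ x∈   = subst (_< colours) (sym (recolour-old c x∈)) (in-range x∈)
      at-v-proper : ∀ {y} → y ∈ S ∖ v → Proper c v y
      at-v-proper y∈ v~′y eq = avoids y∈ v~′y (trans (sym (recolour-old c y∈)) (trans (sym eq) (recolour-v c)))
      at-v-uniform : ∀ {y} → y ∈ S ∖ v → Uniform c v y
      at-v-uniform y∈ v∈I y∈I v~y =
        trans (recolour-v c) (sym (trans (recolour-old c y∈) (agrees y∈ v∈I y∈I v~y)))

    ColouredNeighbour : ℕ → Set
    ColouredNeighbour c = ∃ λ u → u ∈ S ∖ v × v ~ u × colour u ≡ c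

    coloured-neighbour? : ∀ c → Dec (ColouredNeighbour c)
    coloured-neighbour? c = any? (λ u → u ∈? S ∖ v ×-dec v ~? u ×-dec colour u ≟ℕ c)

    -- If no edge at v lies inside I and every colour occurs next to v, then v takes a new
    -- colour, and together with one neighbour of each colour it forms a larger clique.
    fresh : (∀ {u} → u ∈ S ∖ v → v ~ u → ¬ (v ∈ I × u ∈ I)) →
            (∀ (c : Fin colours) → ColouredNeighbour (toℕ c)) → Colouring S
    fresh outside neighbour = record
      { colours = suc colours ; colour = recolour colours ; in-range = range
      ; proper = recolour-proper colours at-v-proper ; I-uniform = recolour-uniform colours at-v-uniform
      ; clique = clique′ ; clique⊆S = clique′⊆S ; clique-adj = clique′-adj }
      where
      range : ∀ {x} → x ∈ S → recolour colours x < suc colours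
      range x∈S with ∖-split {v = v} x∈S
      ... | inj₁ refl = subst (_< suc colours) (sym (recolour-v colours)) ≤-refl
      ... | inj₂ x∈   = subst (_< suc colours) (sym (recolour-old colours x∈)) (<-trans (in-range x∈) ≤-refl)
      at-v-proper : ∀ {y} → y ∈ S ∖ v → Proper colours v y
      at-v-proper y∈ _ eq =
        <⇒≱ (in-range y∈) (≤-reflexive (trans (sym (recolour-v colours)) (trans eq (recolour-old colours y∈))))
      at-v-uniform : ∀ {y} → y ∈ S ∖ v → Uniform colours v y
      at-v-uniform y∈ v∈I y∈I v~y = ⊥-elim (outside y∈ v~y (v∈I , y∈I))
      rep : Fin colours → Fin n
      rep c = proj₁ (neighbour c)
      rep∈ : ∀ c → rep c ∈ S ∖ v
      rep∈ c = proj₁ (proj₂ (neighbour c))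
      v~rep : ∀ c → v ~ rep c
      v~rep c = proj₁ (proj₂ (proj₂ (neighbour c)))
      rep-colour : ∀ c → colour (rep c) ≡ toℕ c
      rep-colour c = proj₂ (proj₂ (proj₂ (neighbour c)))
      same-colour : ∀ {c d} → colour (rep c) ≡ colour (rep d) → c ≡ d
      same-colour {c} {d} eq = toℕ-injective (trans (sym (rep-colour c)) (trans eq (rep-colour d)))
      v~′rep : ∀ c → v ~′ rep c
      v~′rep c = ~⇒~′ (v~rep c) (outside (rep∈ c) (v~rep c))
      rep~′rep : ∀ {c d} → c ≢ d → rep c ~′ rep d
      rep~′rep {c} {d} c≢d =
        ~⇒~′ rep~rep (λ (c∈I , d∈I) → c≢d (same-colour (I-uniform (rep∈ c) (rep∈ d) c∈I d∈I rep~rep)))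
        where
        rep~rep = neighbours-adjacent (rep∈ c) (rep∈ d) (v~rep c) (v~rep d) (c≢d ∘ same-colour ∘ cong colour)
      clique′ : Fin (suc colours) → Fin n
      clique′ zero    = v
      clique′ (suc c) = rep c
      clique′⊆S : ∀ i → clique′ i ∈ S
      clique′⊆S zero    = proj₁ v-simplicial
      clique′⊆S (suc c) = ∖⇒∈ (rep∈ c)
      clique′-adj : ∀ {i j} → i ≢ j → clique′ i ~′ clique′ j
      clique′-adj {zero}  {zero}  0≢0 = ⊥-elim (0≢0 refl)
      clique′-adj {zero}  {suc d} _   = v~′rep d
      clique′-adj {suc c} {zero}  _   = ~′-sym (v~′rep c)
      clique′-adj {suc c} {suc d} c≢d = rep~′rep (c≢d ∘ cong suc)

    without-inside-edges : (∀ {u} → u ∈ S ∖ v → v ~ u → ¬ (v ∈ I × u ∈ I)) → Colouring S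
    without-inside-edges outside with any? (λ (c : Fin colours) → ¬? (coloured-neighbour? (toℕ c)))
    ... | yes (c , missing) =
      reuse (toℕ c) (toℕ<n c) (λ u∈ v~′u uc≡c → missing (_ , u∈ , ~′⇒~ v~′u , uc≡c))
            (λ u∈ v∈I u∈I v~u → ⊥-elim (outside u∈ v~u (v∈I , u∈I)))
    ... | no all-present =
      fresh outside (λ c → decidable-stable (coloured-neighbour? (toℕ c)) (λ none → all-present (c , none)))

    -- If v ∈ I has a G-neighbour u₀ ∈ I in S ∖ v, v takes the colour of u₀: its other
    -- I-neighbours are adjacent to u₀ (v is simplicial), and its G′-neighbours u lie outside
    -- I, so u₀ ~′ u.
    extend : Colouring S
    extend with v ∈? I | any? (λ u → u ∈? S ∖ v ×-dec v ~? u ×-dec u ∈? I)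
    ... | no v∉I  | _       = without-inside-edges (λ _ _ (v∈I , _) → v∉I v∈I)
    ... | yes _   | no none = without-inside-edges (λ u∈ v~u (_ , u∈I) → none (_ , u∈ , v~u , u∈I))
    ... | yes v∈I | yes (u₀ , u₀∈ , v~u₀ , u₀∈I) = reuse (colour u₀) (in-range u₀∈) avoids agrees
      where
      avoids : ∀ {u} → u ∈ S ∖ v → v ~′ u → colour u ≢ colour u₀
      avoids {u} u∈ v~′u uc≡u₀c with u ≟ u₀
      ... | yes refl = ~′-not-inside v~′u v∈I u₀∈I
      ... | no u≢u₀  = proper u₀∈ u∈ u₀~′u (sym uc≡u₀c)
        where
        u₀~′u = ~⇒~′ (neighbours-adjacent u₀∈ u∈ v~u₀ (~′⇒~ v~′u) (u≢u₀ ∘ sym))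
                     (λ (_ , u∈I) → ~′-not-inside v~′u v∈I u∈I)
      agrees : ∀ {u} → u ∈ S ∖ v → v ∈ I → u ∈ I → v ~ u → colour u ≡ colour u₀
      agrees {u} u∈ _ u∈I v~u with u ≟ u₀
      ... | yes refl = refl
      ... | no u≢u₀  = I-uniform u∈ u₀∈ u∈I u₀∈I (neighbours-adjacent u∈ u₀∈ v~u v~u₀ u≢u₀)

  colouring : ∀ S → Colouring S
  colouring S = go S (⊂-wellFounded S)
    where
    go : ∀ S → Acc _⊂_ S → Colouring S
    go S (acc smaller) with nonempty? S
    ... | no empty = empty-colouring (λ x∈S → empty (_ , x∈S))
    ... | yes (x , x∈S) with simplicial-vertex S x∈S
    ...   | v , v-simplicial = Extend.extend S v v-simplicial (go (S ∖ v) (smaller (∖-⊂ (proj₁ v-simplicial))))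

  perfect : Perfect G′
  perfect S = χ≡ω (induced G′ S) colourable has-clique
    where
    open Colouring (colouring S)
    as-∈ : ∀ {x} → lookup S x ≡ true → x ∈ S
    as-∈ {x} = lookup⇒[]= x S
    colourable : Colorable (induced G′ S) colours
    colourable = (λ (x , x∈S) → fromℕ< (in-range (as-∈ x∈S))) ,
                 λ (x , x∈S) (y , y∈S) x~′y eq →
                   proper (as-∈ x∈S) (as-∈ y∈S) x~′y
                     (trans (sym (toℕ-fromℕ< _)) (trans (cong toℕ eq) (toℕ-fromℕ< _)))
    has-clique : HasClique (induced G′ S) colours
    has-clique = members , adjacent-injective (induced G′ S) (λ i j → clique-adj) , λ i j → clique-adj
      where
      members : Fin colours → InducedVertex S
      members i = clique i , []=⇒lookup (clique⊆S i)

lemma14 : (n : ℕ) (G : FinGraph n) (I : Subset n) →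
    Chordal G → Perfect (deleteInsideEdges G I)
lemma14 n G I chordal = DeletedEdgesColouring.perfect G I (SimplicialVertices.simplicial-vertex G chordal)
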